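{- Let $\Phi$ be a sequence of permutations such that $\Phi = (\phi_n,\phi_{n-1},\ldots,\phi_2)$ where $\phi_j\in{\cal S}_{I_{j-1}}$ for $j=n,n-1,\ldots,2$, and let $\alpha\in{\cal S}_{I_n}$. The following conditions are equivalent: (i) $\Phi^\alpha$ satisfies the same condition, i.e. $\Phi^\alpha = (\phi'_n,\ldots,\phi'_2)$ with $\phi'_j\in{\cal S}_{I_{j-1}}$ for $j=n,\ldots,2$; (ii) $\alpha = \mathrm{id}_{I_n}$ or $\alpha$ is the transposition $(1,2)$.
   Context: Notation: $I_k=\{1,\ldots,k\}$, ${\cal S}_Y$ is the group of permutations of a set $Y$, $n\ge 3$. For a sequence $\Phi=(\phi_n,\ldots,\phi_2)$ with $\phi_j\in{\cal S}_{I_{j-1}}$ (so $\phi_2=\mathrm{id}_{\{1\}}$; here the associated ordering of $I_n$ is $x_j=j$, and $\mathrm{Dom}(\phi_j)=I_{j-1}$), and a bijection $\alpha$ of $I_n$, the conjugated sequence is $\Phi^\alpha=(\phi'_n,\ldots,\phi'_2)$ where $\phi'_j=\phi_j^{\alpha}$ is the permutation of $\alpha(I_{j-1})$ determined by $\alpha\circ\phi_j=\phi'_j\circ\alpha$ (i.e. $\phi'_j=\alpha\phi_j\alpha^{ -1}$ restricted to $\alpha(I_{j-1})$). -}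

module Defs where

open import Data.Nat using (ℕ; suc; _≤_; _∸_)
open import Data.Fin using (Fin; toℕ)
open import Data.Fin.Permutation using (Permutation′; _⟨$⟩ʳ_; _∘ₚ_; flip)
open import Relation.Binary.PropositionalEquality using (_≡_)

-- Convention: I_n = {1,…,n} is modelled by Fin n, the element i ∈ I_n being
-- the Fin index with toℕ = i - 1.  Hence I_k ⊆ I_n is {x : Fin n | toℕ x < k}.
--
-- A permutation of I_k (k ≤ n) is modelled as a permutation of I_n that fixes
-- every element outside I_k (its support lies in I_k).
InSym : ∀ {n} → ℕ → Permutation′ n → Set
InSym k σ = ∀ x → k ≤ toℕ x → σ ⟨$⟩ʳ x ≡ x

record Seq (n : ℕ) : Set where
  field
    φ   : (j : ℕ) → 2 ≤ j → j ≤ n → Permutation′ n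
    inS : ∀ j (p : 2 ≤ j) (q : j ≤ n) → InSym (j ∸ 1) (φ j p q)

-- conjugate σ^α = α ∘ σ ∘ α⁻¹   (π₁ ∘ₚ π₂ applies π₁ first)
conj : ∀ {n} → Permutation′ n → Permutation′ n → Permutation′ n
conj α σ = flip α ∘ₚ σ ∘ₚ α

conjSeq : ∀ {n} → Permutation′ n → Seq n → (j : ℕ) → 2 ≤ j → j ≤ n → Permutation′ n
conjSeq α Φ j p q = conj α (Seq.φ Φ j p q)

ConjSatisfies : ∀ {n} → Permutation′ n → Seq n → Set
ConjSatisfies {n} α Φ = ∀ j (p : 2 ≤ j) (q : j ≤ n) → InSym (j ∸ 1) (conjSeq α Φ j p q)

-- Conjugation by α carries the support of σ onto α(supp σ).  Taking φ_j to be
-- the transposition (1, j−1) therefore forces α(1), α(j−1) ∈ I_{j−1}: α maps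
-- I_2 into itself and α(y) ≤ y for y ≥ 2.  By injectivity α then maps
-- {3,…,n} into itself without ever increasing, so it fixes that set pointwise
-- (descend from y to α(y)); that is, α ∈ S_{I_2} = {id, (1 2)}.  Conversely
-- S_{I_2} normalises S_{I_k} for every k ≥ 2, and S_{I_1} is trivial.
module Submission where

open import Defs
open import Data.Nat using (ℕ; suc; _∸_; _≤_; _<_; z≤n; s≤s; s≤s⁻¹; _≤?_)
open import Data.Nat.Properties using (≤-refl; ≤-trans; ≤-reflexive; <⇒≤; <⇒≱; ≰⇒>; n≤0⇒n≡0; m≤n⇒m<n∨m≡n)
open import Data.Fin using (Fin; zero; suc; toℕ; fromℕ<)
open import Data.Fin.Properties using (_≟_; toℕ<n; toℕ≤pred[n]; toℕ-fromℕ<; toℕ-injective)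
open import Data.Fin.Permutation using (Permutation′; _≈_; id; transpose; _⟨$⟩ʳ_; _⟨$⟩ˡ_; inverseˡ; inverseʳ)
open import Data.Product using (_×_; _,_; proj₁; proj₂)
open import Data.Sum using (_⊎_; inj₁; inj₂; [_,_])
open import Function.Bundles using (_⇔_; Injection; mk⇔)
open import Function.Construct.Composition using (_⇔-∘_)
open import Function.Definitions using (Injective)
open import Function.Properties.Inverse using (↔⇒↣)
open import Relation.Nullary using (yes; no; contradiction)
open import Relation.Nullary.Decidable using (dec-true; dec-false)
open import Relation.Binary.PropositionalEquality
  using (_≡_; _≢_; refl; sym; trans; cong; subst; ≢-sym; module ≡-Reasoning)

private
  variable
    n k k′ : ℕ

permutation-injective : (π : Permutation′ n) → Injective _≡_ _≡_ (π ⟨$⟩ʳ_)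
permutation-injective π = Injection.injective (↔⇒↣ π)

toℕ-separates : {x y : Fin n} → toℕ x < k → k ≤ toℕ y → y ≢ x
toℕ-separates x<k k≤y refl = <⇒≱ x<k k≤y

below-two : {u : Fin (suc (suc n))} → toℕ u < 2 → u ≡ zero ⊎ u ≡ suc zero
below-two {u = zero}          _                   = inj₁ refl
below-two {u = suc zero}      _                   = inj₂ refl
below-two {u = suc (suc _)}   (s≤s (s≤s ()))

below-two-covered : {u v w : Fin (suc (suc n))} → toℕ u < 2 → toℕ v < 2 → toℕ w < 2 →
                    u ≢ v → w ≡ u ⊎ w ≡ v
below-two-covered u<2 v<2 w<2 u≢v with below-two u<2 | below-two v<2 | below-two w<2
... | inj₁ refl | inj₁ refl | _         = contradiction refl u≢v
... | inj₂ refl | inj₂ refl | _         = contradiction refl u≢v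
... | inj₁ refl | inj₂ refl | inj₁ refl = inj₁ refl
... | inj₁ refl | inj₂ refl | inj₂ refl = inj₂ refl
... | inj₂ refl | inj₁ refl | inj₁ refl = inj₂ refl
... | inj₂ refl | inj₁ refl | inj₂ refl = inj₁ refl

injective-preserves-≥2 : (f : Fin (suc (suc n)) → Fin (suc (suc n))) → Injective _≡_ _≡_ f →
                         toℕ (f zero) < 2 → toℕ (f (suc zero)) < 2 →
                         ∀ y → 2 ≤ toℕ y → 2 ≤ toℕ (f y)
injective-preserves-≥2 f f-inj f₀<2 f₁<2 y 2≤y with 2 ≤? toℕ (f y)
... | yes 2≤fy = 2≤fy
... | no  2≰fy with below-two-covered f₀<2 f₁<2 (≰⇒> 2≰fy) (λ e → contradiction (f-inj e) λ ())
...   | inj₁ fy≡f₀ = contradiction (f-inj fy≡f₀) (toℕ-separates (s≤s z≤n) 2≤y)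
...   | inj₂ fy≡f₁ = contradiction (f-inj fy≡f₁) (toℕ-separates ≤-refl 2≤y)

injective-non-increasing-fixes : (f : Fin n → Fin n) → Injective _≡_ _≡_ f →
                                 (∀ y → k ≤ toℕ y → k ≤ toℕ (f y)) →
                                 (∀ y → k ≤ toℕ y → toℕ (f y) ≤ toℕ y) →
                                 ∀ y → k ≤ toℕ y → f y ≡ y
injective-non-increasing-fixes {n} {k} f f-inj preserves non-increasing y = fixes-below n y (toℕ<n y)
  where
  fixes-below : ∀ b y → toℕ y < b → k ≤ toℕ y → f y ≡ y
  fixes-below (suc b) y y<b k≤y with m≤n⇒m<n∨m≡n (non-increasing y k≤y)
  ... | inj₁ fy<y = f-inj (fixes-below b (f y) (≤-trans fy<y (s≤s⁻¹ y<b)) (preserves y k≤y))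
  ... | inj₂ fy≡y = toℕ-injective fy≡y

module _ (i j : Fin n) where
  transpose-fixes : {x : Fin n} → x ≢ i → x ≢ j → transpose i j ⟨$⟩ʳ x ≡ x
  transpose-fixes {x} x≢i x≢j rewrite dec-false (x ≟ i) x≢i | dec-false (x ≟ j) x≢j = refl

  transpose-left : transpose i j ⟨$⟩ʳ i ≡ j
  transpose-left rewrite dec-true (i ≟ i) refl = refl

  transpose-right : j ≢ i → transpose i j ⟨$⟩ʳ j ≡ i
  transpose-right j≢i rewrite dec-false (j ≟ i) j≢i | dec-true (j ≟ j) refl = refl

InSym-mono : (σ : Permutation′ n) → k ≤ k′ → InSym k σ → InSym k′ σ
InSym-mono σ k≤k′ σ∈ x k′≤x = σ∈ x (≤-trans k≤k′ k′≤x)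

InSym-≈ : (α σ : Permutation′ n) → α ≈ σ → InSym k σ → InSym k α
InSym-≈ α σ α≈σ σ∈ x k≤x = trans (α≈σ x) (σ∈ x k≤x)

InSym-preserves-< : (σ : Permutation′ n) → InSym k σ →
                    {x : Fin n} → toℕ x < k → toℕ (σ ⟨$⟩ʳ x) < k
InSym-preserves-< {k = k} σ σ∈ {x} x<k with k ≤? toℕ (σ ⟨$⟩ʳ x)
... | yes k≤σx = contradiction (permutation-injective σ (σ∈ _ k≤σx)) (toℕ-separates x<k k≤σx)
... | no  k≰σx = ≰⇒> k≰σx

InSym-inverse : (α : Permutation′ n) → InSym k α → ∀ x → k ≤ toℕ x → α ⟨$⟩ˡ x ≡ x
InSym-inverse α α∈ x k≤x = permutation-injective α (trans (inverseʳ α) (sym (α∈ x k≤x)))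

conj-InSym : (α σ : Permutation′ n) → InSym k α → InSym k σ → InSym k (conj α σ)
conj-InSym α σ α∈ σ∈ x k≤x = begin
  α ⟨$⟩ʳ (σ ⟨$⟩ʳ (α ⟨$⟩ˡ x)) ≡⟨ cong (λ z → α ⟨$⟩ʳ (σ ⟨$⟩ʳ z)) (InSym-inverse α α∈ x k≤x) ⟩
  α ⟨$⟩ʳ (σ ⟨$⟩ʳ x)          ≡⟨ cong (α ⟨$⟩ʳ_) (σ∈ x k≤x) ⟩
  α ⟨$⟩ʳ x                   ≡⟨ α∈ x k≤x ⟩
  x                          ∎
  where open ≡-Reasoning

conj-of-trivial : (α σ : Permutation′ n) → (∀ x → σ ⟨$⟩ʳ x ≡ x) → InSym k (conj α σ)
conj-of-trivial α σ σ≈id x _ = trans (cong (α ⟨$⟩ʳ_) (σ≈id _)) (inverseʳ α)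

conj-InSym⇒moved-< : (α σ : Permutation′ n) → InSym k (conj α σ) →
                     {x : Fin n} → σ ⟨$⟩ʳ x ≢ x → toℕ (α ⟨$⟩ʳ x) < k
conj-InSym⇒moved-< {k = k} α σ ασα⁻¹∈ {x} σx≢x with k ≤? toℕ (α ⟨$⟩ʳ x)
... | yes k≤αx = contradiction (permutation-injective α (trans ασα⁻¹x≡ασx (ασα⁻¹∈ _ k≤αx))) σx≢x
  where
  ασα⁻¹x≡ασx : α ⟨$⟩ʳ (σ ⟨$⟩ʳ x) ≡ α ⟨$⟩ʳ (σ ⟨$⟩ʳ (α ⟨$⟩ˡ (α ⟨$⟩ʳ x)))
  ασα⁻¹x≡ασx = cong (λ z → α ⟨$⟩ʳ (σ ⟨$⟩ʳ z)) (sym (inverseˡ α))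
... | no  k≰αx = ≰⇒> k≰αx

InSym1⇒trivial : (σ : Permutation′ (suc n)) → InSym 1 σ → ∀ x → σ ⟨$⟩ʳ x ≡ x
InSym1⇒trivial σ σ∈ zero    = toℕ-injective (n≤0⇒n≡0 (s≤s⁻¹ (InSym-preserves-< σ σ∈ (s≤s z≤n))))
InSym1⇒trivial σ σ∈ (suc x) = σ∈ (suc x) (s≤s z≤n)

InSym2⇒conjSatisfies : (α : Permutation′ (suc n)) → InSym 2 α →
                       (Φ : Seq (suc n)) → ConjSatisfies α Φ
InSym2⇒conjSatisfies α α∈ Φ 2                   p q =
  conj-of-trivial α (Seq.φ Φ 2 p q) (InSym1⇒trivial (Seq.φ Φ 2 p q) (Seq.inS Φ 2 p q))
InSym2⇒conjSatisfies α α∈ Φ (suc (suc (suc j))) p q =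
  conj-InSym α (Seq.φ Φ _ p q) (InSym-mono α (s≤s (s≤s z≤n)) α∈) (Seq.inS Φ _ p q)
InSym2⇒conjSatisfies α α∈ Φ 1 (s≤s ()) _

transpositionSeq : Seq (suc n)
transpositionSeq {n} = record { φ = φ ; inS = inS }
  where
  φ : (j : ℕ) → 2 ≤ j → j ≤ suc n → Permutation′ (suc n)
  φ (suc (suc j)) _ j≤n = transpose (fromℕ< (<⇒≤ j≤n)) zero
  φ 1 (s≤s ()) _

  inS : ∀ j (p : 2 ≤ j) (q : j ≤ suc n) → InSym (j ∸ 1) (φ j p q)
  inS (suc (suc j)) _ j≤n x j<x = transpose-fixes _ zero
    (toℕ-separates (≤-reflexive (cong suc (toℕ-fromℕ< (<⇒≤ j≤n)))) j<x)
    (toℕ-separates (s≤s z≤n) j<x)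
  inS 1 (s≤s ()) _

transpositionSeq-bounds : (α : Permutation′ (suc n)) → ConjSatisfies α transpositionSeq →
                          (i : Fin (suc n)) → i ≢ zero → suc (suc (toℕ i)) ≤ suc n →
                          toℕ (α ⟨$⟩ʳ i) < suc (toℕ i) × toℕ (α ⟨$⟩ʳ zero) < suc (toℕ i)
transpositionSeq-bounds α H i i≢0 q =
    conj-InSym⇒moved-< α (transpose i zero) conj∈ (λ e → i≢0 (trans (sym e) τi≡0))
  , conj-InSym⇒moved-< α (transpose i zero) conj∈ (λ e → i≢0 (trans (sym τ0≡i) e))
  where
  τi≡0 : transpose i zero ⟨$⟩ʳ i ≡ zero
  τi≡0 = transpose-left i zero

  τ0≡i : transpose i zero ⟨$⟩ʳ zero ≡ i
  τ0≡i = transpose-right i zero (≢-sym i≢0)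

  conj∈ : InSym (suc (toℕ i)) (conj α (transpose i zero))
  conj∈ = subst (λ i′ → InSym (suc (toℕ i)) (conj α (transpose i′ zero)))
                (toℕ-injective (toℕ-fromℕ< (<⇒≤ q))) (H _ (s≤s (s≤s z≤n)) q)

transpositionSeq⇒InSym2 : (α : Permutation′ (suc (suc (suc n)))) →
                          ConjSatisfies α transpositionSeq → InSym 2 α
transpositionSeq⇒InSym2 {n} α H =
  injective-non-increasing-fixes (α ⟨$⟩ʳ_) (permutation-injective α)
    (injective-preserves-≥2 (α ⟨$⟩ʳ_) (permutation-injective α) (proj₂ bounds₁) (proj₁ bounds₁))
    non-increasing
  where
  bounds₁ : toℕ (α ⟨$⟩ʳ suc zero) < 2 × toℕ (α ⟨$⟩ʳ zero) < 2
  bounds₁ = transpositionSeq-bounds α H (suc zero) (λ ()) (s≤s (s≤s (s≤s z≤n)))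

  non-increasing : ∀ y → 2 ≤ toℕ y → toℕ (α ⟨$⟩ʳ y) ≤ toℕ y
  non-increasing y 2≤y with suc (suc (toℕ y)) ≤? suc (suc (suc n))
  ... | yes q    = s≤s⁻¹ (proj₁ (transpositionSeq-bounds α H y (toℕ-separates (s≤s z≤n) 2≤y) q))
  ... | no  last = ≤-trans (toℕ≤pred[n] (α ⟨$⟩ʳ y)) (s≤s⁻¹ (s≤s⁻¹ (≰⇒> last)))

conjSatisfies⇔InSym2 : (α : Permutation′ (suc (suc (suc n)))) →
                       ((Φ : Seq (suc (suc (suc n)))) → ConjSatisfies α Φ) ⇔ InSym 2 α
conjSatisfies⇔InSym2 α =
  mk⇔ (λ H → transpositionSeq⇒InSym2 α (H transpositionSeq)) (InSym2⇒conjSatisfies α)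

transpose01∈InSym2 : InSym 2 (transpose {suc (suc n)} zero (suc zero))
transpose01∈InSym2 (suc (suc x)) _ = refl
transpose01∈InSym2 (suc zero) (s≤s ())

InSym2⇔id⊎transpose01 : (α : Permutation′ (suc (suc n))) →
                         InSym 2 α ⇔ (α ≈ id ⊎ α ≈ transpose zero (suc zero))
InSym2⇔id⊎transpose01 α = mk⇔ classify
  [ (λ α≈id → InSym-≈ α id α≈id λ _ _ → refl)
  , (λ α≈τ → InSym-≈ α (transpose zero (suc zero)) α≈τ transpose01∈InSym2)
  ]
  where
  classify : InSym 2 α → α ≈ id ⊎ α ≈ transpose zero (suc zero)
  classify α∈ with below-two (InSym-preserves-< α α∈ {zero} (s≤s z≤n))
                 | below-two (InSym-preserves-< α α∈ {suc zero} ≤-refl)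
  ... | inj₁ α₀≡0 | inj₂ α₁≡1 =
    inj₁ λ { zero → α₀≡0 ; (suc zero) → α₁≡1 ; (suc (suc y)) → α∈ _ (s≤s (s≤s z≤n)) }
  ... | inj₂ α₀≡1 | inj₁ α₁≡0 =
    inj₂ λ { zero → α₀≡1 ; (suc zero) → α₁≡0 ; (suc (suc y)) → α∈ _ (s≤s (s≤s z≤n)) }
  ... | inj₁ α₀≡0 | inj₁ α₁≡0 = contradiction (permutation-injective α (trans α₀≡0 (sym α₁≡0))) λ ()
  ... | inj₂ α₀≡1 | inj₂ α₁≡1 = contradiction (permutation-injective α (trans α₀≡1 (sym α₁≡1))) λ ()

lemma2p6 : (m : ℕ) → (α : Permutation′ (suc (suc (suc m)))) →
    ((Φ : Seq (suc (suc (suc m)))) → ConjSatisfies α Φ) ⇔ (α ≈ id ⊎ α ≈ transpose zero (suc zero))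
lemma2p6 m α = InSym2⇔id⊎transpose01 α ⇔-∘ conjSatisfies⇔InSym2 α
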